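{- Let $t,t'\in B_n$ with $t\ne t'$, and let $G$ be a digraph such that $\mathbb{A}(G)$ satisfies $t\approx t'$. Then $O_G\le Y_{t,t'}+1$.
   Context: The graph algebra $\mathbb{A}(G)$ of a digraph $G=(V,E)$ (loops allowed) is the groupoid on $V\cup\{\infty\}$ with $uv=u$ if $(u,v)\in E$ and $uv=\infty$ otherwise. $B_n$ is the set of bracketings of $x_1\cdots x_n$. For $t\in B_n$, $G(t)$ is the rooted tree on $X_n=\{x_1,\dots,x_n\}$ defined recursively: $G(x_i)$ is the vertex $x_i$; for $t=t_1t_2$, $G(t)$ is $G(t_1)\cup G(t_2)$ plus an edge from the root of $G(t_1)$ to the root of $G(t_2)$, rooted at the root of $G(t_1)$. For a rooted tree $T$, $T_x$ is the subtree induced by $x$ and its descendants, rooted at $x$, and $h$ denotes height. With $T=G(t)$, $T'=G(t')$: $Y_{t,t'}$ is the largest integer $m$ such that for all $x\in X_n$, if $h(T_x)\le m$ or $h(T'_x)\le m$ then $T_x=T'_x$. A strongly connected component is trivial if it is a single vertex without loop, nontrivial otherwise. An outlet from a nontrivial strongly connected component $K$ is a path $v_0\to\dots\to v_\ell$ with $v_0\in K$ and $v_1,\dots,v_\ell$ in trivial strongly connected components. $O_G$ is the maximum length of an outlet ($\infty$ if unbounded, $-\infty$ if none). -}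

module Defs where

open import Data.Nat using (ℕ; zero; suc; _+_)
open import Data.Fin using (Fin; zero; suc; _↑ˡ_; _↑ʳ_; inject₁)
open import Data.Integer using (ℤ; +_; _≤_) renaming (_+_ to _+ℤ_)
open import Data.Maybe using (Maybe; just; nothing)
open import Data.Product using (Σ; ∃; _×_)
open import Data.Sum using (_⊎_)
open import Relation.Nullary using (¬_)
open import Relation.Binary.PropositionalEquality using (_≡_; _≢_)
open import Function.Bundles using (_⇔_)

-- Bracketings B_n of x_1 ⋯ x_n : binary trees with n leaves; the leaves,
-- read left to right, are x_1, …, x_n (variables are indexed by Fin n).

data Br : ℕ → Set where
  leaf : Br 1
  node : ∀ {m k} → Br m → Br k → Br (m + k)

root : ∀ {n} → Br n → Fin n
root leaf = zero
root (node {m} {k} s₁ s₂) = root s₁ ↑ˡ k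

data Edge : ∀ {n} → Br n → Fin n → Fin n → Set where
  left  : ∀ {m k} {s₁ : Br m} {s₂ : Br k} {u v} →
          Edge s₁ u v → Edge (node s₁ s₂) (u ↑ˡ k) (v ↑ˡ k)
  right : ∀ {m k} {s₁ : Br m} {s₂ : Br k} {u v} →
          Edge s₂ u v → Edge (node s₁ s₂) (m ↑ʳ u) (m ↑ʳ v)
  mid   : ∀ {m k} {s₁ : Br m} {s₂ : Br k} →
          Edge (node s₁ s₂) (root s₁ ↑ˡ k) (m ↑ʳ root s₂)

data TPath {n} (t : Br n) : Fin n → Fin n → ℕ → Set where
  here : ∀ {x} → TPath t x x 0
  step : ∀ {x y z ℓ} → Edge t x y → TPath t y z ℓ → TPath t x z (suc ℓ)

Desc : ∀ {n} → Br n → Fin n → Fin n → Set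
Desc t x y = ∃ λ ℓ → TPath t x y ℓ

HeightLE : ∀ {n} → Br n → Fin n → ℤ → Set
HeightLE t x m = ∀ y ℓ → TPath t x y ℓ → + ℓ ≤ m

SubtreeEq : ∀ {n} → Br n → Br n → Fin n → Set
SubtreeEq t t' x =
  (∀ y → Desc t x y ⇔ Desc t' x y) ×
  (∀ u v → (Desc t x u × Desc t x v × Edge t u v) ⇔ (Desc t' x u × Desc t' x v × Edge t' u v))

YProp : ∀ {n} → Br n → Br n → ℤ → Set
YProp t t' m = ∀ x → (HeightLE t x m ⊎ HeightLE t' x m) → SubtreeEq t t' x

IsY : ∀ {n} → Br n → Br n → ℤ → Set
IsY t t' y = YProp t t' y × (∀ m → YProp t t' m → m ≤ y)

record Digraph : Set₁ where
  field
    V : Set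
    E : V → V → Set

module _ (G : Digraph) where
  open Digraph G

  -- The operation of 𝔸(G) on V ∪ {∞} (∞ = nothing), as its graph:
  -- Op a b c  means  a · b = c.
  data Op : Maybe V → Maybe V → Maybe V → Set where
    edge   : ∀ {u v} → E u v → Op (just u) (just v) (just u)
    noedge : ∀ {u v} → ¬ E u v → Op (just u) (just v) nothing
    ∞ˡ     : ∀ {b} → Op nothing b nothing
    ∞ʳ     : ∀ {u} → Op (just u) nothing nothing

  data Eval : ∀ {n} → Br n → (Fin n → Maybe V) → Maybe V → Set where
    leaf : ∀ {ρ} → Eval leaf ρ (ρ zero)
    node : ∀ {m k} {s₁ : Br m} {s₂ : Br k} {ρ a b c} →
           Eval s₁ (λ i → ρ (i ↑ˡ k)) a →
           Eval s₂ (λ i → ρ (m ↑ʳ i)) b →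
           Op a b c → Eval (node s₁ s₂) ρ c

  Satisfies : ∀ {n} → Br n → Br n → Set
  Satisfies t t' = ∀ ρ w → Eval t ρ w ⇔ Eval t' ρ w

  data Reach : V → V → Set where
    refl : ∀ {u} → Reach u u
    step : ∀ {u v w} → E u v → Reach v w → Reach u w

  -- v lies in a nontrivial strongly connected component:
  -- it has a loop, or its component contains another vertex.
  Nontrivial : V → Set
  Nontrivial v = E v v ⊎ Σ V (λ w → w ≢ v × Reach v w × Reach w v)

  Trivial : V → Set
  Trivial v = ¬ Nontrivial v

  record Outlet (ℓ : ℕ) : Set where
    field
      vs     : Fin (suc ℓ) → V
      edges  : ∀ (i : Fin ℓ) → E (vs (inject₁ i)) (vs (suc i))
      start  : Nontrivial (vs zero)
      triv   : ∀ (i : Fin ℓ) → Trivial (vs (suc i))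

  OutletBound : ℤ → Set
  OutletBound b = ∀ ℓ → Outlet ℓ → + ℓ ≤ b

-- A homomorphism f : G(t) → G makes t evaluate to f(root), so 𝔸(G) ⊨ t ≈ t′ turns every
-- homomorphism of G(t) into one of G(t′).  Let v₀ → v₁ → ⋯ → v_ℓ be an outlet and x a vertex
-- whose subtree in G(t) has height < ℓ.  Map a descendant of x at distance d to v_{d+1}, and
-- every other vertex along a walk that runs round a cycle through v₀ and sits at v₀ on the
-- parent of x.  Doing this with any vertex a of G(t)_x in place of x, a G(t′)-edge a → b maps
-- to an edge v₁ → f(b); as v₁ is trivial, b can be neither a itself nor outside G(t)_a (from
-- where v₀ → v₁ is reachable), so b is a proper G(t)-descendant of a.  Uniqueness of parents
-- and acyclicity upgrade this to G(t)_x = G(t′)_x, i.e. ℓ − 1 has the property defining Y_{t,t′}.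
module Submission where

open import Defs
open import Data.Nat using (ℕ; zero; suc; _+_; _∸_; _≤_; _<_; z≤n; s≤s)
open import Data.Nat.Properties using (+-suc; +-identityʳ; +-cancelˡ-≡; m+1+n≢m; m≤n+m; ≤-trans)
open import Data.Fin using (Fin; zero; suc; _↑ˡ_; _↑ʳ_; splitAt; inject₁)
open import Data.Fin.Properties using (splitAt-↑ˡ; splitAt-↑ʳ)
open import Data.Integer using (ℤ; +_; pred; _≤?_) renaming (_+_ to _+ℤ_; _≤_ to _≤ℤ_)
open import Data.Integer.Properties using (drop‿+≤+; suc-mono; suc-pred) renaming (+-comm to +ℤ-comm)
open import Data.Maybe using (Maybe; just; nothing; maybe′) renaming (map to mapₘ)
open import Data.Maybe.Properties using (just-injective)
open import Data.Product using (∃; _×_; _,_; proj₁; proj₂)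
open import Data.Sum using (inj₁; inj₂; [_,_]′)
open import Data.Empty using (⊥-elim)
open import Function using (_∘_)
open import Function.Bundles using (mk⇔; Equivalence)
open import Function.Construct.Symmetry using (⇔-sym)
open import Relation.Nullary using (Dec; yes; no; ¬_)
open import Relation.Nullary.Decidable using (decidable-stable; ¬¬-excluded-middle)
open import Relation.Binary.PropositionalEquality
open ≡-Reasoning

parent : ∀ {n} → Br n → Fin n → Maybe (Fin n)
parent leaf _ = nothing
parent (node {m} {k} s₁ s₂) i =
  [ (λ u → mapₘ (_↑ˡ k) (parent s₁ u)) ,
    (λ v → just (maybe′ (m ↑ʳ_) (root s₁ ↑ˡ k) (parent s₂ v))) ]′ (splitAt m i)

parent-root : ∀ {n} (t : Br n) → parent t (root t) ≡ nothing
parent-root leaf = refl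
parent-root (node {m} {k} s₁ s₂) rewrite splitAt-↑ˡ m (root s₁) k | parent-root s₁ = refl

parent-edge : ∀ {n} {t : Br n} {a b} → Edge t a b → parent t b ≡ just a
parent-edge (left {m} {k} {v = v} e) rewrite splitAt-↑ˡ m v k | parent-edge e = refl
parent-edge (right {m} {k} {v = v} e) rewrite splitAt-↑ʳ m k v | parent-edge e = refl
parent-edge (mid {m} {k} {s₂ = s₂}) rewrite splitAt-↑ʳ m k (root s₂) | parent-root s₂ = refl

parent-unique : ∀ {n} {t : Br n} {a a′ b} → Edge t a b → Edge t a′ b → a ≡ a′
parent-unique e f = just-injective (trans (sym (parent-edge e)) (parent-edge f))

depth : ∀ {n} → Br n → Fin n → ℕ
depth leaf _ = 0
depth (node {m} s₁ s₂) i = [ depth s₁ , (λ j → suc (depth s₁ (root s₁) + depth s₂ j)) ]′ (splitAt m i)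

depth-root : ∀ {n} (t : Br n) → depth t (root t) ≡ 0
depth-root leaf = refl
depth-root (node {m} {k} s₁ s₂) rewrite splitAt-↑ˡ m (root s₁) k = depth-root s₁

depth-edge : ∀ {n} {t : Br n} {a b} → Edge t a b → depth t b ≡ suc (depth t a)
depth-edge (left {m} {k} {u = u} {v} e) rewrite splitAt-↑ˡ m u k | splitAt-↑ˡ m v k = depth-edge e
depth-edge (right {m} {k} {u = u} {v} e)
  rewrite splitAt-↑ʳ m k u | splitAt-↑ʳ m k v | depth-edge e = cong suc (+-suc _ _)
depth-edge (mid {m} {k} {s₁} {s₂})
  rewrite splitAt-↑ˡ m (root s₁) k | splitAt-↑ʳ m k (root s₂) | depth-root s₂ = cong suc (+-identityʳ _)

_++ᵖ_ : ∀ {n} {t : Br n} {a b c i j} → TPath t a b i → TPath t b c j → TPath t a c (i + j)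
here ++ᵖ q = q
step e p ++ᵖ q = step e (p ++ᵖ q)

snoc : ∀ {n} {t : Br n} {a b c i} → TPath t a b i → Edge t b c → TPath t a c (suc i)
snoc here e = step e here
snoc (step e′ p) e = step e′ (snoc p e)

unsnoc : ∀ {n} {t : Br n} {a c i} → TPath t a c (suc i) → ∃ λ b → TPath t a b i × Edge t b c
unsnoc (step e here) = _ , here , e
unsnoc (step e (step e′ p)) with unsnoc (step e′ p)
... | b , q , f = b , step e q , f

path-depth : ∀ {n} {t : Br n} {a b ℓ} → TPath t a b ℓ → depth t b ≡ depth t a + ℓ
path-depth here = sym (+-identityʳ _)
path-depth {ℓ = suc ℓ} (step e p) = trans (path-depth p) (trans (cong (_+ ℓ) (depth-edge e)) (sym (+-suc _ ℓ)))

path-length-unique : ∀ {n} {t : Br n} {a b i j} → TPath t a b i → TPath t a b j → i ≡ j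
path-length-unique p q = +-cancelˡ-≡ _ _ _ (trans (sym (path-depth p)) (path-depth q))

acyclic : ∀ {n} {t : Br n} {a ℓ} → ¬ TPath t a a (suc ℓ)
acyclic p = m+1+n≢m _ (sym (path-depth p))

DecDesc : ∀ {n} → Br n → Set
DecDesc t = ∀ a z → Dec (Desc t a z)

HeightBelow : ∀ {n} → Br n → Fin n → ℕ → Set
HeightBelow t a L = ∀ y ℓ → TPath t a y ℓ → ℓ < L

heightLE⇒heightBelow : ∀ {n} {t : Br n} {a L} → HeightLE t a (+ L) → HeightBelow t a (suc L)
heightLE⇒heightBelow h y ℓ p = s≤s (drop‿+≤+ (h y ℓ p))

heightBelow-desc : ∀ {n} {t : Br n} {a b k L} → HeightBelow t a L → TPath t a b k → HeightBelow t b L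
heightBelow-desc {k = k} ha q y ℓ p = ≤-trans (s≤s (m≤n+m ℓ k)) (ha y (k + ℓ) (q ++ᵖ p))

SubtreeEq-sym : ∀ {n} {t t′ : Br n} {x} → SubtreeEq t′ t x → SubtreeEq t t′ x
SubtreeEq-sym (vertices , edges) = ⇔-sym ∘ vertices , λ u v → ⇔-sym (edges u v)

module _ (G : Digraph) where
  open Digraph G

  IsHom : ∀ {n} → Br n → (Fin n → V) → Set
  IsHom t f = ∀ {a b} → Edge t a b → E (f a) (f b)

  hom⇒eval : ∀ {n} (t : Br n) {f} → IsHom t f → Eval G t (just ∘ f) (just (f (root t)))
  hom⇒eval leaf h = leaf
  hom⇒eval (node s₁ s₂) h = node (hom⇒eval s₁ (h ∘ left)) (hom⇒eval s₂ (h ∘ right)) (edge (h mid))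

  eval⇒hom : ∀ {n} (t : Br n) {f a} → Eval G t (just ∘ f) (just a) → IsHom t f × a ≡ f (root t)
  eval⇒hom leaf leaf = (λ ()) , refl
  eval⇒hom (node s₁ s₂) (node ev₁ ev₂ (edge e)) with eval⇒hom s₁ ev₁ | eval⇒hom s₂ ev₂
  ... | h₁ , refl | h₂ , refl = hom , refl
    where
      hom : IsHom (node s₁ s₂) _
      hom (left e′) = h₁ e′
      hom (right e′) = h₂ e′
      hom mid = e

  HomTransfer : ∀ {n} → Br n → Br n → Set
  HomTransfer t t′ = ∀ f → IsHom t f → IsHom t′ f

  satisfies⇒homTransfer : ∀ {n} {t t′ : Br n} → Satisfies G t t′ → HomTransfer t t′
  satisfies⇒homTransfer {t = t} sat f h =
    proj₁ (eval⇒hom _ (Equivalence.to (sat (just ∘ f) (just (f (root t)))) (hom⇒eval t h)))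

  _◅◅_ : ∀ {a b c} → Reach G a b → Reach G b c → Reach G a c
  refl ◅◅ q = q
  step e p ◅◅ q = step e (p ◅◅ q)

  trivial-no-return : ∀ {a b} → Trivial G a → E a b → ¬ Reach G b a
  trivial-no-return {a} {b} triv e r =
    triv (inj₂ (b , (λ b≡a → triv (inj₁ (subst (E a) b≡a e))) , step e refl , r))

  nontrivial⇒cycle : ∀ {v₀} → Nontrivial G v₀ → ∃ λ b → E v₀ b × Reach G b v₀
  nontrivial⇒cycle (inj₁ loop) = _ , loop , refl
  nontrivial⇒cycle (inj₂ (w , w≢v₀ , refl , _)) = ⊥-elim (w≢v₀ refl)
  nontrivial⇒cycle (inj₂ (w , _ , step e r , r′)) = _ , e , (r ◅◅ r′)

  record ReturningWalk (v₀ : V) (D : ℕ) : Set where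
    field
      w       : ℕ → V
      w-edge  : ∀ j → E (w j) (w (suc j))
      w-reach : ∀ j → Reach G (w j) v₀
      w-at    : w D ≡ v₀

  -- Follow a path back to v₀, then go round the cycle v₀ → b₀ ⇝ v₀ forever.
  module CycleWalk {v₀ b₀} (e₀ : E v₀ b₀) (back : Reach G b₀ v₀) where
    walk : ∀ {a} → Reach G a v₀ → ℕ → V
    walk {a} _ zero = a
    walk refl (suc j) = walk back j
    walk (step _ r) (suc j) = walk r j

    walk-edge : ∀ {a} (r : Reach G a v₀) j → E (walk r j) (walk r (suc j))
    walk-edge refl zero = e₀
    walk-edge (step e _) zero = e
    walk-edge refl (suc j) = walk-edge back j
    walk-edge (step _ r) (suc j) = walk-edge r j

    walk-reach : ∀ {a} (r : Reach G a v₀) j → Reach G (walk r j) v₀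
    walk-reach r zero = r
    walk-reach refl (suc j) = walk-reach back j
    walk-reach (step _ r) (suc j) = walk-reach r j

    walk-returns : ∀ N {a} (r : Reach G a v₀) → ∃ λ s → walk r (N + s) ≡ v₀
    walk-returns zero refl = 0 , refl
    walk-returns zero (step _ r) with walk-returns zero r
    ... | s , p = suc s , p
    walk-returns (suc N) refl = walk-returns N back
    walk-returns (suc N) (step _ r) = walk-returns N r

  returning-walk : ∀ {v₀} → Nontrivial G v₀ → ∀ D → ReturningWalk v₀ D
  returning-walk nt D with nontrivial⇒cycle nt
  ... | _ , e₀ , back =
    let s , returns = walk-returns D refl in record
      { w = λ j → walk refl (j + s)
      ; w-edge = λ j → walk-edge refl (j + s)
      ; w-reach = λ j → walk-reach refl (j + s)
      ; w-at = returns
      }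
    where open CycleWalk e₀ back

  vertexAt : ∀ {ℓ} → (Fin (suc ℓ) → V) → ℕ → V
  vertexAt vs zero = vs zero
  vertexAt {zero} vs (suc j) = vs zero
  vertexAt {suc ℓ} vs (suc j) = vertexAt (vs ∘ suc) j

  vertexAt-edge : ∀ {ℓ} (vs : Fin (suc ℓ) → V) → (∀ i → E (vs (inject₁ i)) (vs (suc i))) →
                  ∀ j → j < ℓ → E (vertexAt vs j) (vertexAt vs (suc j))
  vertexAt-edge vs es zero (s≤s _) = es zero
  vertexAt-edge vs es (suc j) (s≤s j<ℓ) = vertexAt-edge (vs ∘ suc) (es ∘ suc) j j<ℓ

  module OutletArgument {L} (out : Outlet G (suc L)) where
    open Outlet out

    module Assignment {n} (t : Br n) (dec : DecDesc t) (x : Fin n) (hx : HeightBelow t x (suc L)) where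
      open ReturningWalk (returning-walk start (depth t x ∸ 1)) public

      ρ : Fin n → V
      ρ z with dec x z
      ... | yes (ℓ , _) = vertexAt vs (suc ℓ)
      ... | no _ = w (depth t z)

      ρ-desc : ∀ {z ℓ} → TPath t x z ℓ → ρ z ≡ vertexAt vs (suc ℓ)
      ρ-desc {z} p with dec x z
      ... | yes (_ , p′) = cong (vertexAt vs ∘ suc) (path-length-unique p′ p)
      ... | no ¬p = ⊥-elim (¬p (_ , p))

      ρ-nondesc : ∀ {z} → ¬ Desc t x z → ρ z ≡ w (depth t z)
      ρ-nondesc {z} ¬p with dec x z
      ... | yes p = ⊥-elim (¬p p)
      ... | no _ = refl

      ρ-hom : IsHom t ρ
      ρ-hom {u} {v} e = by-cases (dec x u) (dec x v)
        where
          by-cases : Dec (Desc t x u) → Dec (Desc t x v) → E (ρ u) (ρ v)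
          by-cases (yes (ℓ , p)) _ =
            subst₂ E (sym (ρ-desc p)) (sym (ρ-desc (snoc p e)))
              (vertexAt-edge vs edges (suc ℓ) (hx v (suc ℓ) (snoc p e)))
          by-cases (no ¬p) (yes (zero , here)) =
            subst₂ E (sym above-x) (sym (ρ-desc here)) (edges zero)
            where
              above-x : ρ u ≡ vs zero
              above-x = begin
                ρ u                  ≡⟨ ρ-nondesc ¬p ⟩
                w (depth t u)        ≡⟨ cong (w ∘ (_∸ 1)) (depth-edge e) ⟨
                w (depth t x ∸ 1)    ≡⟨ w-at ⟩
                vs zero              ∎
          by-cases (no ¬p) (yes (suc ℓ , q)) with unsnoc q
          ... | _ , p , f with parent-unique f e
          ... | refl = ⊥-elim (¬p (ℓ , p))
          by-cases (no ¬p) (no ¬q) =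
            subst₂ E (sym (ρ-nondesc ¬p)) (sym (trans (ρ-nondesc ¬q) (cong w (depth-edge e)))) (w-edge (depth t u))

    module Transfer {n} {t t′ : Br n} (dec : DecDesc t) (transfer : HomTransfer t t′) where

      edge⇒proper-desc : ∀ {a b} → HeightBelow t a (suc L) → Edge t′ a b → ∃ λ ℓ → TPath t a b (suc ℓ)
      edge⇒proper-desc {a} {b} ha e = from-image (dec a b) (transfer ρ ρ-hom e)
        where
          open Assignment t dec a ha
          from-image : Dec (Desc t a b) → E (ρ a) (ρ b) → ∃ λ ℓ → TPath t a b (suc ℓ)
          from-image (yes (suc ℓ , p)) _ = ℓ , p
          from-image (yes (zero , here)) loop =
            ⊥-elim (triv zero (inj₁ (subst₂ E (ρ-desc here) (ρ-desc here) loop)))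
          from-image (no ¬p) image =
            ⊥-elim (trivial-no-return (triv zero) (subst₂ E (ρ-desc here) (ρ-nondesc ¬p) image)
                      (w-reach (depth t b) ◅◅ step (edges zero) refl))

      lift-path : ∀ {a y ℓ} → HeightBelow t a (suc L) → TPath t′ a y ℓ → ∃ λ ℓ′ → TPath t a y ℓ′ × ℓ ≤ ℓ′
      lift-path ha here = 0 , here , z≤n
      lift-path ha (step e p) with edge⇒proper-desc ha e
      ... | k , q with lift-path (heightBelow-desc ha q) p
      ... | ℓ′ , q′ , ℓ≤ℓ′ = suc k + ℓ′ , q ++ᵖ q′ , s≤s (≤-trans ℓ≤ℓ′ (m≤n+m ℓ′ k))

      heightBelow-transfer : ∀ {a} → HeightBelow t a (suc L) → HeightBelow t′ a (suc L)
      heightBelow-transfer ha y ℓ p with lift-path ha p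
      ... | ℓ′ , q , ℓ≤ℓ′ = ≤-trans (s≤s ℓ≤ℓ′) (ha y ℓ′ q)

      desc-transfer : ∀ {a y} → HeightBelow t a (suc L) → Desc t′ a y → Desc t a y
      desc-transfer ha (_ , p) with lift-path ha p
      ... | ℓ′ , q , _ = ℓ′ , q

    -- If the t-parent c of v were not u, then u would be a t′-descendant of c
    -- (its t′-parent being unique), hence a t-descendant of c, closing a cycle u ⇝ c ⇝ u in t.
    edge-transfer : ∀ {n} {t t′ : Br n} → DecDesc t → DecDesc t′ → HomTransfer t t′ → HomTransfer t′ t →
                    ∀ {u v} → HeightBelow t u (suc L) → Edge t′ u v → Edge t u v
    edge-transfer dec dec′ tr tr′ hu e with Transfer.edge⇒proper-desc dec tr hu e
    ... | _ , q with unsnoc q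
    ... | _ , here , f = f
    ... | _ , step g p , f
      with Transfer.edge⇒proper-desc dec′ tr′
             (Transfer.heightBelow-transfer dec tr (heightBelow-desc hu (step g p))) f
    ... | _ , q′ with unsnoc q′
    ... | _ , r , f′ with parent-unique f′ e
    ... | refl = ⊥-elim (acyclic (step g p ++ᵖ
                   proj₂ (Transfer.desc-transfer dec tr (heightBelow-desc hu (step g p)) (_ , r))))

    subtree-eq : ∀ {n} {t t′ : Br n} → DecDesc t → DecDesc t′ → HomTransfer t t′ → HomTransfer t′ t →
                 ∀ {x} → HeightBelow t x (suc L) → SubtreeEq t t′ x
    subtree-eq {t = t} {t′} dec dec′ tr tr′ {x} hx = (λ _ → mk⇔ to from) , (λ _ _ → mk⇔ to-edge from-edge)
      where
        hx′ : HeightBelow t′ x (suc L)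
        hx′ = Transfer.heightBelow-transfer dec tr hx

        to : ∀ {y} → Desc t x y → Desc t′ x y
        to = Transfer.desc-transfer dec′ tr′ hx′

        from : ∀ {y} → Desc t′ x y → Desc t x y
        from = Transfer.desc-transfer dec tr hx

        to-edge : ∀ {u v} → Desc t x u × Desc t x v × Edge t u v → Desc t′ x u × Desc t′ x v × Edge t′ u v
        to-edge (du , dv , e) = to du , to dv , edge-transfer dec′ dec tr′ tr (heightBelow-desc hx′ (proj₂ (to du))) e

        from-edge : ∀ {u v} → Desc t′ x u × Desc t′ x v × Edge t′ u v → Desc t x u × Desc t x v × Edge t u v
        from-edge (du , dv , e) = from du , from dv , edge-transfer dec dec′ tr tr′ (heightBelow-desc hx (proj₂ (from du))) e

  outlet⇒YProp : ∀ {n} {t t′ : Br n} → Satisfies G t t′ → DecDesc t → DecDesc t′ →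
                 ∀ {ℓ} → Outlet G ℓ → YProp t t′ (pred (+ ℓ))
  outlet⇒YProp sat dec dec′ {zero} _ x (inj₁ h) with h x 0 here
  ... | ()
  outlet⇒YProp sat dec dec′ {zero} _ x (inj₂ h) with h x 0 here
  ... | ()
  outlet⇒YProp {t = t} {t′} sat dec dec′ {suc L} out x =
    [ subtree-eq dec dec′ tr tr′ ∘ heightLE⇒heightBelow ,
      SubtreeEq-sym ∘ subtree-eq dec′ dec tr′ tr ∘ heightLE⇒heightBelow ]′
    where
      open OutletArgument out
      tr : HomTransfer t t′
      tr = satisfies⇒homTransfer sat
      tr′ : HomTransfer t′ t
      tr′ = satisfies⇒homTransfer (λ ρ v → ⇔-sym (sat ρ v))

¬¬-∀Fin : ∀ {n} {P : Fin n → Set} → (∀ i → ¬ ¬ P i) → ¬ ¬ (∀ i → P i)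
¬¬-∀Fin {zero} _ k = k (λ ())
¬¬-∀Fin {suc n} h k = h zero (λ p₀ → ¬¬-∀Fin (h ∘ suc) (λ ps → k (λ { zero → p₀ ; (suc i) → ps i })))

-- Descendance is only decidable classically here; that suffices, the goal being decidable.
¬¬-decDesc : ∀ {n} (t : Br n) → ¬ ¬ DecDesc t
¬¬-decDesc t = ¬¬-∀Fin λ a → ¬¬-∀Fin λ z → ¬¬-excluded-middle

pred≤⇒≤+1 : ∀ {i j} → pred i ≤ℤ j → i ≤ℤ j +ℤ + 1
pred≤⇒≤+1 {i} {j} le = subst₂ _≤ℤ_ (suc-pred i) (+ℤ-comm (+ 1) j) (suc-mono le)

-- The hypothesis t ≢ t′ only guarantees that Y_{t,t′} exists, which IsY already provides.
lemma6p10 : ∀ {n : ℕ} (t t' : Br n) → t ≢ t' → (G : Digraph) → Satisfies G t t' →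
    (y : ℤ) → IsY t t' y → OutletBound G (y +ℤ + 1)
lemma6p10 t t' _ G sat y (_ , maximal) ℓ out =
  decidable-stable (+ ℓ ≤? y +ℤ + 1) λ ℓ≰ →
    ¬¬-decDesc t λ dec → ¬¬-decDesc t' λ dec′ →
      ℓ≰ (pred≤⇒≤+1 (maximal _ (outlet⇒YProp G sat dec dec′ out)))
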